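{- For every integer $n\geq 0$ and every integer $s\geq 0$, the coefficient of $q^s$ in the polynomial $\phi_n(q)$ equals $rac(n,s)$.
   Context: A composition of $n$ of length $s$ is a sequence $\sigma=(\sigma_1,\ldots,\sigma_s)$ of positive integers with $\sum_i\sigma_i=n$; the empty composition is the unique composition of $0$, of length $0$. A composition is anti-palindromic if $\sigma_i\neq\sigma_{s-i+1}$ for all $i$ with $i\neq\frac{s+1}{2}$ (the empty composition is vacuously anti-palindromic). Two anti-palindromic compositions of $n$ of length $s$ are flip-equivalent if one is obtained from the other by swapping the entries $\sigma_i$ and $\sigma_{s-i+1}$ for some set of indices $i\neq\frac{s+1}{2}$; each equivalence class (a reduced anti-palindromic composition) has $2^{\lfloor s/2\rfloor}$ elements. $rac(n,s)$ is the number of flip-equivalence classes of anti-palindromic compositions of $n$ of length $s$, i.e. $rac(n,s)=ac(n,s)/2^{\lfloor s/2\rfloor}$ where $ac(n,s)$ is the number of anti-palindromic compositions of $n$ of length $s$. The polynomials $\phi_n(q)$ are defined by $\phi_0(q)=1$, $\phi_1(q)=q$, $\phi_2(q)=q$, $\phi_3(q)=q+q^2$, and $\phi_n(q)=\phi_{n-1}(q)+\phi_{n-2}(q)+(q^2-1)\phi_{n-3}(q)$ for $n>3$. -}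

module Defs where

open import Data.Nat using (ℕ; zero; suc; _+_; _∸_; _^_; _/_; _≟_; ⌊_/2⌋)
open import Data.Nat.Properties using (m^n≢0)
open import Data.Integer as ℤ using (ℤ; +_)
open import Data.List using (List; []; _∷_; length; reverse; zip; map; concatMap; upTo; filter)
open import Data.Product using (_×_; _,_; proj₁; proj₂)
open import Relation.Nullary using (¬_; Dec; yes; no)
open import Relation.Binary.PropositionalEquality using (_≡_; _≢_)

compositions : ℕ → ℕ → List (List ℕ)
compositions zero    zero    = [] ∷ []
compositions (suc n) zero    = []
compositions n       (suc s) =
  concatMap (λ k → map (suc k ∷_) (compositions (n ∸ suc k) s)) (upTo n)

-- σ is anti-palindromic iff σ_i ≢ σ_{s-i+1} for every i ≠ (s+1)/2.
-- Pair σ with its reverse: position i (0-based) pairs σ_i with σ_{s-1-i}.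
-- The unique i with i = s-1-i (s odd, the middle) is excluded.
antiPalPairs : ℕ → List (ℕ × (ℕ × ℕ)) → Set
antiPalPairs s [] = Data.Unit.⊤
  where import Data.Unit
antiPalPairs s ((i , (a , b)) ∷ rest) = MiddleOrDistinct × antiPalPairs s rest
  where
  MiddleOrDistinct : Set
  MiddleOrDistinct = (i + i + 1 ≢ s) → a ≢ b

indexed : ℕ → List (ℕ × ℕ) → List (ℕ × (ℕ × ℕ))
indexed i [] = []
indexed i (p ∷ ps) = (i , p) ∷ indexed (suc i) ps

IsAntiPalindromic : List ℕ → Set
IsAntiPalindromic σ = antiPalPairs (length σ) (indexed 0 (zip σ (reverse σ)))

antiPal? : ∀ s ps → Dec (antiPalPairs s ps)
antiPal? s [] = yes _
antiPal? s ((i , (a , b)) ∷ rest) with i + i + 1 ≟ s | a ≟ b | antiPal? s rest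
... | _      | _      | no ¬r = no (λ p → ¬r (proj₂ p))
... | yes mid | _     | yes r = yes ((λ nm → Data.Empty.⊥-elim (nm mid)) , r)
  where import Data.Empty
... | no nm  | no ne  | yes r = yes ((λ _ → ne) , r)
... | no nm  | yes eq | yes r = no (λ p → proj₁ p nm eq)

isAntiPal? : ∀ σ → Dec (IsAntiPalindromic σ)
isAntiPal? σ = antiPal? (length σ) (indexed 0 (zip σ (reverse σ)))

ac : ℕ → ℕ → ℕ
ac n s = length (filter isAntiPal? (compositions n s))

rac : ℕ → ℕ → ℕ
rac n s = _/_ (ac n s) (2 ^ ⌊ s /2⌋) {{m^n≢0 2 ⌊ s /2⌋}}

-- Polynomials over ℤ as coefficient sequences (coeff k = coefficient of q^k)

Poly : Set
Poly = ℕ → ℤ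

_⊕_ : Poly → Poly → Poly
(f ⊕ g) k = f k ℤ.+ g k

mulQ²-1 : Poly → Poly
mulQ²-1 f zero = ℤ.- f zero
mulQ²-1 f (suc zero) = ℤ.- f (suc zero)
mulQ²-1 f (suc (suc k)) = f k ℤ.- f (suc (suc k))

mono : ℕ → Poly
mono j k with j ≟ k
... | yes _ = + 1
... | no _  = + 0

φ : ℕ → Poly
φ 0 = mono 0
φ 1 = mono 1
φ 2 = mono 1
φ 3 = mono 1 ⊕ mono 2
φ (suc (suc (suc (suc n)))) =
  φ (suc (suc (suc n))) ⊕ (φ (suc (suc n)) ⊕ mulQ²-1 (φ (suc n)))

{-# OPTIONS --safe #-}
-- Deleting the first and last entries of an anti-palindromic composition of
-- length s + 2 leaves an anti-palindromic composition of length s, and the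
-- deleted pair (a , b) may be any pair with a ≠ b. Up to flips it is an
-- unordered pair {a < b}, and there are ⌊(m - 1)/2⌋ of those with a + b = m,
-- whose generating function is x³/((1 - x)(1 - x²)). Hence
-- Σₙ rac(n, s + 2) xⁿ = x³/((1 - x)(1 - x²)) · Σₙ rac(n, s) xⁿ.
-- The recurrence of φₙ has characteristic polynomial
-- 1 - x - x² + x³ = (1 - x)(1 - x²), and comparing coefficients of q^(s+2)
-- in it gives the same relation between the coefficients of q^(s+2) and q^s.
module Submission where

open import Defs
open import Data.Bool using (Bool; true; false; _∧_; _∨_; not; if_then_else_)
open import Data.Bool.Properties using (∧-assoc; ∧-identityʳ; not-involutive)
open import Data.Integer using (+_)
import Data.Integer as ℤ
import Data.Integer.Properties as ℤ
import Data.Integer.Tactic.RingSolver as ℤ-Solver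
open import Data.List
  using (List; []; _∷_; _++_; [_]; _∷ʳ_; length; map; concatMap; applyUpTo; upTo; filter; reverse; zip)
open import Data.List.Properties
  using (map-cong; map-applyUpTo; reverse-++; unfold-reverse; length-reverse; length-++; length-zipWith)
open import Data.Nat using (ℕ; zero; suc; pred; _⊓_; _+_; _*_; _∸_; _^_; _/_; _≟_; _<ᵇ_; ⌊_/2⌋)
open import Data.Nat.Properties
  using (+-comm; +-assoc; +-suc; suc-injective; +-identityʳ; *-distribʳ-+; *-assoc; ⊓-idem; m^n≢0; m≢1+m+n;
         +-commutativeSemigroup; *-commutativeSemigroup)
open import Data.Nat.DivMod using (m*n/n≡m)
open import Data.Nat.ListAction using (sum)
open import Data.Nat.Tactic.RingSolver using (solve-∀)
open import Data.Product using (_×_; _,_)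
open import Function using (_∘_; mk⇔)
open import Relation.Nullary using (does)
open import Relation.Nullary.Decidable using (does-≡; does-⇔; dec-false; ¬?; _×-dec_; _→-dec_)
open import Relation.Unary using (Pred; Decidable)
open import Relation.Binary.PropositionalEquality
  using (_≡_; refl; sym; trans; cong; cong₂; module ≡-Reasoning)

open import Algebra.Properties.CommutativeSemigroup +-commutativeSemigroup
  using (interchange) renaming (x∙yz≈y∙xz to +-left-comm)
open import Algebra.Properties.CommutativeSemigroup *-commutativeSemigroup
  using () renaming (x∙yz≈y∙xz to *-left-comm)

splitSum : ℕ → (ℕ → ℕ → ℕ) → ℕ
splitSum zero    g = 0
splitSum (suc n) g = g 1 n + splitSum n (g ∘ suc)

splitSum-cong : ∀ n {g h : ℕ → ℕ → ℕ} → (∀ a m → g a m ≡ h a m) → splitSum n g ≡ splitSum n h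
splitSum-cong zero    g≡h = refl
splitSum-cong (suc n) g≡h = cong₂ _+_ (g≡h 1 n) (splitSum-cong n (g≡h ∘ suc))

splitSum-suc : ∀ n g → splitSum (suc n) g ≡ g (suc n) 0 + splitSum n (λ a m → g a (suc m))
splitSum-suc zero    g = refl
splitSum-suc (suc n) g = begin
  g 1 (suc n) + splitSum (suc n) (g ∘ suc)
    ≡⟨ cong (_+_ (g 1 (suc n))) (splitSum-suc n (g ∘ suc)) ⟩
  g 1 (suc n) + (g (suc (suc n)) 0 + splitSum n (λ a m → g (suc a) (suc m)))
    ≡⟨ +-left-comm (g 1 (suc n)) (g (suc (suc n)) 0) _ ⟩
  g (suc (suc n)) 0 + splitSum (suc n) (λ a m → g a (suc m)) ∎
  where open ≡-Reasoning

splitSum-zeros : ∀ n → splitSum n (λ _ _ → 0) ≡ 0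
splitSum-zeros zero    = refl
splitSum-zeros (suc n) = splitSum-zeros n

splitSum-+ : ∀ n g h → splitSum n (λ a m → g a m + h a m) ≡ splitSum n g + splitSum n h
splitSum-+ zero    g h = refl
splitSum-+ (suc n) g h =
  trans (cong (_+_ (g 1 n + h 1 n)) (splitSum-+ n (g ∘ suc) (h ∘ suc)))
        (interchange (g 1 n) (h 1 n) _ _)

splitSum-*ʳ : ∀ n g c → splitSum n (λ a m → g a m * c) ≡ splitSum n g * c
splitSum-*ʳ zero    g c = refl
splitSum-*ʳ (suc n) g c =
  trans (cong (_+_ (g 1 n * c)) (splitSum-*ʳ n (g ∘ suc) c)) (sym (*-distribʳ-+ c (g 1 n) _))

splitSum-swap : ∀ n (h : ℕ → ℕ → ℕ → ℕ) →
  splitSum n (λ a m → splitSum m (λ b r → h a b r)) ≡ splitSum n (λ b m → splitSum m (λ a r → h a b r))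
splitSum-swap zero    h = refl
splitSum-swap (suc n) h = begin
  splitSum n (h 1) + splitSum n (λ a m → splitSum m (h (suc a)))
    ≡⟨ cong (_+_ (splitSum n (h 1))) (splitSum-swap n (h ∘ suc)) ⟩
  splitSum n (h 1) + splitSum n (λ b m → splitSum m (λ a r → h (suc a) b r))
    ≡⟨ sym (splitSum-+ n (h 1) (λ b m → splitSum m (λ a r → h (suc a) b r))) ⟩
  splitSum n (λ b m → splitSum (suc m) (λ a r → h a b r))
    ≡⟨ sym (splitSum-suc n (λ b m → splitSum m (λ a r → h a b r))) ⟩
  splitSum (suc n) (λ b m → splitSum m (λ a r → h a b r)) ∎
  where open ≡-Reasoning

splitSum-applyUpTo : ∀ n g → sum (applyUpTo (λ k → g (suc k) (n ∸ suc k)) n) ≡ splitSum n g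
splitSum-applyUpTo zero    g = refl
splitSum-applyUpTo (suc n) g = cong (_+_ (g 1 n)) (splitSum-applyUpTo n (g ∘ suc))

conv : ℕ → (ℕ → ℕ) → (ℕ → ℕ) → ℕ
conv zero    D f = D 0 * f 0
conv (suc n) D f = D (suc n) * f 0 + conv n D (f ∘ suc)

conv-cong : ∀ n D {f g : ℕ → ℕ} → (∀ r → f r ≡ g r) → conv n D f ≡ conv n D g
conv-cong zero    D f≡g = cong (D 0 *_) (f≡g 0)
conv-cong (suc n) D f≡g = cong₂ _+_ (cong (D (suc n) *_) (f≡g 0)) (conv-cong n D (f≡g ∘ suc))

conv-*ʳ : ∀ n D f c → conv n D (λ r → f r * c) ≡ conv n D f * c
conv-*ʳ zero    D f c = sym (*-assoc (D 0) (f 0) c)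
conv-*ʳ (suc n) D f c = begin
  D (suc n) * (f 0 * c) + conv n D (λ r → f (suc r) * c)
    ≡⟨ cong₂ _+_ (sym (*-assoc (D (suc n)) (f 0) c)) (conv-*ʳ n D (f ∘ suc) c) ⟩
  D (suc n) * f 0 * c + conv n D (f ∘ suc) * c
    ≡⟨ sym (*-distribʳ-+ c (D (suc n) * f 0) _) ⟩
  conv (suc n) D f * c ∎
  where open ≡-Reasoning

-- Unordered pairs of distinct positive integers with sum m

𝟙 : Bool → ℕ
𝟙 b = if b then 1 else 0

ltPairs : ℕ → ℕ
ltPairs m = ⌊ pred m /2⌋

splitSum-<ᵇ : ∀ n → splitSum n (λ a b → 𝟙 (a <ᵇ b)) ≡ ltPairs n
splitSum-<ᵇ 0 = refl
splitSum-<ᵇ 1 = refl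
splitSum-<ᵇ (suc (suc n)) =
  trans (cong (_+_ (𝟙 (1 <ᵇ suc n))) (trans (splitSum-suc n (λ a b → 𝟙 (suc a <ᵇ b))) (splitSum-<ᵇ n)))
        (last n)
  where
  last : ∀ n → 𝟙 (1 <ᵇ suc n) + ltPairs n ≡ ltPairs (suc (suc n))
  last zero    = refl
  last (suc n) = refl

splitSum-nested-<ᵇ : ∀ n f →
  splitSum n (λ a m → splitSum m (λ b r → 𝟙 (a <ᵇ b) * f r)) ≡ conv n ltPairs f
splitSum-nested-<ᵇ zero    f = refl
splitSum-nested-<ᵇ (suc n) f = begin
  splitSum (suc n) (λ a m → splitSum m (λ b r → 𝟙 (a <ᵇ b) * f r))
    ≡⟨ splitSum-suc n (λ a m → splitSum m (λ b r → 𝟙 (a <ᵇ b) * f r)) ⟩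
  splitSum n (λ a m → splitSum (suc m) (λ b r → 𝟙 (a <ᵇ b) * f r))
    ≡⟨ splitSum-cong n (λ a m → splitSum-suc m (λ b r → 𝟙 (a <ᵇ b) * f r)) ⟩
  splitSum n (λ a m → 𝟙 (a <ᵇ suc m) * f 0 + splitSum m (λ b r → 𝟙 (a <ᵇ b) * f (suc r)))
    ≡⟨ splitSum-+ n _ _ ⟩
  splitSum n (λ a m → 𝟙 (a <ᵇ suc m) * f 0)
    + splitSum n (λ a m → splitSum m (λ b r → 𝟙 (a <ᵇ b) * f (suc r)))
    ≡⟨ cong₂ _+_ (splitSum-*ʳ n (λ a m → 𝟙 (a <ᵇ suc m)) (f 0)) (splitSum-nested-<ᵇ n (f ∘ suc)) ⟩
  splitSum n (λ a m → 𝟙 (a <ᵇ suc m)) * f 0 + conv n ltPairs (f ∘ suc)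
    ≡⟨ cong (λ x → x * f 0 + conv n ltPairs (f ∘ suc))
            (trans (sym (splitSum-suc n (λ a b → 𝟙 (a <ᵇ b)))) (splitSum-<ᵇ (suc n))) ⟩
  conv (suc n) ltPairs f ∎
  where open ≡-Reasoning

-- The generating function of ltPairs is x³/((1 - x)(1 - x²)).
conv-ltPairs-recurrence : ∀ m g →
  conv (3 + m) ltPairs g + conv m ltPairs g ≡ conv (2 + m) ltPairs g + conv (1 + m) ltPairs g + g m
conv-ltPairs-recurrence zero    g = trans (+-identityʳ _) (trans (+-identityʳ _) (+-identityʳ _))
conv-ltPairs-recurrence (suc m) g =
  regroup (ltPairs (2 + m)) (ltPairs (1 + m)) (g 0) (conv-ltPairs-recurrence m (g ∘ suc))
  where
  -- The suc x is ltPairs (4 + m), which reduces to 1 + ltPairs (2 + m).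
  regroup : ∀ x y G {A B C D E} → A + B ≡ C + D + E →
    (suc x * G + A) + (y * G + B) ≡ ((suc y * G + C) + (x * G + D)) + E
  regroup x y G {A} {B} {C} {D} {E} eq = begin
    (suc x * G + A) + (y * G + B)       ≡⟨ lhs x y G A B ⟩
    (G + x * G + y * G) + (A + B)       ≡⟨ cong (_+_ (G + x * G + y * G)) eq ⟩
    (G + x * G + y * G) + (C + D + E)   ≡⟨ rhs x y G C D E ⟩
    ((suc y * G + C) + (x * G + D)) + E ∎
    where
    open ≡-Reasoning
    lhs : ∀ x y G A B → (suc x * G + A) + (y * G + B) ≡ (G + x * G + y * G) + (A + B)
    lhs = solve-∀
    rhs : ∀ x y G C D E → (G + x * G + y * G) + (C + D + E) ≡ ((suc y * G + C) + (x * G + D)) + E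
    rhs = solve-∀

private variable A B : Set

count : (A → Bool) → List A → ℕ
count P []       = 0
count P (x ∷ xs) = 𝟙 (P x) + count P xs

count-++ : ∀ (P : A → Bool) xs ys → count P (xs ++ ys) ≡ count P xs + count P ys
count-++ P []       ys = refl
count-++ P (x ∷ xs) ys =
  trans (cong (_+_ (𝟙 (P x))) (count-++ P xs ys)) (sym (+-assoc (𝟙 (P x)) (count P xs) _))

count-cong : ∀ {P Q : A → Bool} xs → (∀ x → P x ≡ Q x) → count P xs ≡ count Q xs
count-cong []       P≡Q = refl
count-cong (x ∷ xs) P≡Q = cong₂ _+_ (cong 𝟙 (P≡Q x)) (count-cong xs P≡Q)

count-map : ∀ (P : B → Bool) (f : A → B) xs → count P (map f xs) ≡ count (P ∘ f) xs
count-map P f []       = refl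
count-map P f (x ∷ xs) = cong (_+_ (𝟙 (P (f x)))) (count-map P f xs)

count-concatMap : ∀ (P : B → Bool) (F : A → List B) xs →
  count P (concatMap F xs) ≡ sum (map (count P ∘ F) xs)
count-concatMap P F []       = refl
count-concatMap P F (x ∷ xs) =
  trans (count-++ P (F x) (concatMap F xs)) (cong (_+_ (count P (F x))) (count-concatMap P F xs))

count-∧ : ∀ c (P : A → Bool) xs → count (λ x → c ∧ P x) xs ≡ 𝟙 c * count P xs
count-∧ true  P xs = sym (+-identityʳ _)
count-∧ false P []       = refl
count-∧ false P (x ∷ xs) = count-∧ false P xs

length-filter≡count : ∀ {p} {P : Pred A p} (P? : Decidable P) xs →
  length (filter P? xs) ≡ count (does ∘ P?) xs
length-filter≡count P? []       = refl
length-filter≡count P? (x ∷ xs) with does (P? x)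
... | true  = cong suc (length-filter≡count P? xs)
... | false = length-filter≡count P? xs

compCount : (List ℕ → Bool) → ℕ → ℕ → ℕ
compCount P n s = count P (compositions n s)

compositions-suc : ∀ n s →
  compositions n (suc s) ≡ concatMap (λ k → map (suc k ∷_) (compositions (n ∸ suc k) s)) (upTo n)
compositions-suc zero    s = refl
compositions-suc (suc n) s = refl

compCount-suc : ∀ P n s → compCount P n (suc s) ≡ splitSum n (λ a m → compCount (P ∘ (a ∷_)) m s)
compCount-suc P n s = begin
  count P (compositions n (suc s))
    ≡⟨ cong (count P) (compositions-suc n s) ⟩
  count P (concatMap (λ k → map (suc k ∷_) (compositions (n ∸ suc k) s)) (upTo n))
    ≡⟨ count-concatMap P _ (upTo n) ⟩
  sum (map (λ k → count P (map (suc k ∷_) (compositions (n ∸ suc k) s))) (upTo n))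
    ≡⟨ cong sum (map-cong (λ k → count-map P (suc k ∷_) (compositions (n ∸ suc k) s)) (upTo n)) ⟩
  sum (map (λ k → compCount (P ∘ (suc k ∷_)) (n ∸ suc k) s) (upTo n))
    ≡⟨ cong sum (map-applyUpTo (λ k → k) _ n) ⟩
  sum (applyUpTo (λ k → compCount (P ∘ (suc k ∷_)) (n ∸ suc k) s) n)
    ≡⟨ splitSum-applyUpTo n (λ a m → compCount (P ∘ (a ∷_)) m s) ⟩
  splitSum n (λ a m → compCount (P ∘ (a ∷_)) m s) ∎
  where open ≡-Reasoning

compCount-sucʳ : ∀ s P n → compCount P n (suc s) ≡ splitSum n (λ a m → compCount (P ∘ (_∷ʳ a)) m s)
compCount-sucʳ zero P n = trans (compCount-suc P n 0) (splitSum-cong n single)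
  where
  single : ∀ a m → compCount (P ∘ (a ∷_)) m 0 ≡ compCount (P ∘ (_∷ʳ a)) m 0
  single a zero    = refl
  single a (suc m) = refl
compCount-sucʳ (suc s) P n = begin
  compCount P n (suc (suc s))
    ≡⟨ compCount-suc P n (suc s) ⟩
  splitSum n (λ a m → compCount (P ∘ (a ∷_)) m (suc s))
    ≡⟨ splitSum-cong n (λ a m → compCount-sucʳ s (P ∘ (a ∷_)) m) ⟩
  splitSum n (λ a m → splitSum m (λ b r → compCount (λ τ → P (a ∷ (τ ∷ʳ b))) r s))
    ≡⟨ splitSum-swap n (λ a b r → compCount (λ τ → P (a ∷ (τ ∷ʳ b))) r s) ⟩
  splitSum n (λ b m → splitSum m (λ a r → compCount (λ τ → P (a ∷ (τ ∷ʳ b))) r s))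
    ≡⟨ sym (splitSum-cong n (λ b m → compCount-suc (P ∘ (_∷ʳ b)) m s)) ⟩
  splitSum n (λ b m → compCount (P ∘ (_∷ʳ b)) m (suc s)) ∎
  where open ≡-Reasoning

antiPalPairsᵇ : ℕ → List (ℕ × (ℕ × ℕ)) → Bool
antiPalPairsᵇ s ps = does (antiPal? s ps)

isAntiPalᵇ : List ℕ → Bool
isAntiPalᵇ σ = does (isAntiPal? σ)

antiPalPairsᵇ-∷ : ∀ s i a b ps → antiPalPairsᵇ s ((i , a , b) ∷ ps) ≡
  (does (i + i + 1 ≟ s) ∨ not (does (a ≟ b))) ∧ antiPalPairsᵇ s ps
antiPalPairsᵇ-∷ s i a b ps =
  trans (does-≡ (antiPal? s ((i , a , b) ∷ ps))
                ((¬? (i + i + 1 ≟ s) →-dec ¬? (a ≟ b)) ×-dec antiPal? s ps))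
        (cong (λ m → (m ∨ not (does (a ≟ b))) ∧ antiPalPairsᵇ s ps) (not-involutive _))

antiPalPairsᵇ-++ : ∀ s xs ys → antiPalPairsᵇ s (xs ++ ys) ≡ antiPalPairsᵇ s xs ∧ antiPalPairsᵇ s ys
antiPalPairsᵇ-++ s []                 ys = refl
antiPalPairsᵇ-++ s ((i , a , b) ∷ xs) ys = begin
  antiPalPairsᵇ s ((i , a , b) ∷ xs ++ ys)
    ≡⟨ antiPalPairsᵇ-∷ s i a b (xs ++ ys) ⟩
  c ∧ antiPalPairsᵇ s (xs ++ ys)
    ≡⟨ cong (c ∧_) (antiPalPairsᵇ-++ s xs ys) ⟩
  c ∧ (antiPalPairsᵇ s xs ∧ antiPalPairsᵇ s ys)
    ≡⟨ sym (∧-assoc c _ _) ⟩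
  (c ∧ antiPalPairsᵇ s xs) ∧ antiPalPairsᵇ s ys
    ≡⟨ cong (_∧ antiPalPairsᵇ s ys) (sym (antiPalPairsᵇ-∷ s i a b xs)) ⟩
  antiPalPairsᵇ s ((i , a , b) ∷ xs) ∧ antiPalPairsᵇ s ys ∎
  where
  open ≡-Reasoning
  c = does (i + i + 1 ≟ s) ∨ not (does (a ≟ b))

antiPalPairsᵇ-shift : ∀ t i ps →
  antiPalPairsᵇ (suc (suc t)) (indexed (suc i) ps) ≡ antiPalPairsᵇ t (indexed i ps)
antiPalPairsᵇ-shift t i []            = refl
antiPalPairsᵇ-shift t i ((a , b) ∷ ps) = begin
  antiPalPairsᵇ (suc (suc t)) ((suc i , a , b) ∷ indexed (suc (suc i)) ps)
    ≡⟨ antiPalPairsᵇ-∷ (suc (suc t)) (suc i) a b (indexed (suc (suc i)) ps) ⟩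
  (does (suc i + suc i + 1 ≟ suc (suc t)) ∨ not (does (a ≟ b)))
    ∧ antiPalPairsᵇ (suc (suc t)) (indexed (suc (suc i)) ps)
    ≡⟨ cong₂ (λ m r → (m ∨ not (does (a ≟ b))) ∧ r)
             (cong (λ k → does (k + 1 ≟ suc t)) (+-suc i i)) (antiPalPairsᵇ-shift t (suc i) ps) ⟩
  (does (i + i + 1 ≟ t) ∨ not (does (a ≟ b))) ∧ antiPalPairsᵇ t (indexed (suc i) ps)
    ≡⟨ sym (antiPalPairsᵇ-∷ t i a b (indexed (suc i) ps)) ⟩
  antiPalPairsᵇ t ((i , a , b) ∷ indexed (suc i) ps) ∎
  where open ≡-Reasoning

indexed-∷ʳ : ∀ i ps p → indexed i (ps ∷ʳ p) ≡ indexed i ps ∷ʳ (i + length ps , p)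
indexed-∷ʳ i []       p = cong (λ k → [ (k , p) ]) (sym (+-identityʳ i))
indexed-∷ʳ i (q ∷ ps) p =
  cong ((i , q) ∷_) (trans (indexed-∷ʳ (suc i) ps p)
                           (cong (λ k → indexed (suc i) ps ∷ʳ (k , p)) (sym (+-suc i (length ps)))))

zip-∷ʳ : ∀ (xs ys : List ℕ) x y → length xs ≡ length ys →
  zip (xs ∷ʳ x) (ys ∷ʳ y) ≡ zip xs ys ∷ʳ (x , y)
zip-∷ʳ []       []       x y _  = refl
zip-∷ʳ (x′ ∷ xs) (y′ ∷ ys) x y eq = cong ((x′ , y′) ∷_) (zip-∷ʳ xs ys x y (suc-injective eq))

isAntiPalᵇ-∷-∷ʳ : ∀ a τ b → isAntiPalᵇ (a ∷ τ ∷ʳ b) ≡ not (does (a ≟ b)) ∧ isAntiPalᵇ τ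
isAntiPalᵇ-∷-∷ʳ a τ b = begin
  isAntiPalᵇ (a ∷ τ ∷ʳ b)
    ≡⟨ cong₂ (λ l r → antiPalPairsᵇ l (indexed 0 (zip (a ∷ τ ∷ʳ b) r))) length-σ reverse-σ ⟩
  antiPalPairsᵇ s (indexed 0 ((a , b) ∷ zip (τ ∷ʳ b) (reverse τ ∷ʳ a)))
    ≡⟨ cong (λ z → antiPalPairsᵇ s (indexed 0 ((a , b) ∷ z)))
            (zip-∷ʳ τ (reverse τ) b a (sym (length-reverse τ))) ⟩
  antiPalPairsᵇ s ((0 , a , b) ∷ indexed 1 (Z ∷ʳ (b , a)))
    ≡⟨ antiPalPairsᵇ-∷ s 0 a b (indexed 1 (Z ∷ʳ (b , a))) ⟩
  a≢b ∧ antiPalPairsᵇ s (indexed 1 (Z ∷ʳ (b , a)))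
    ≡⟨ cong (λ z → a≢b ∧ antiPalPairsᵇ s z) (indexed-∷ʳ 1 Z (b , a)) ⟩
  a≢b ∧ antiPalPairsᵇ s (indexed 1 Z ∷ʳ (1 + length Z , b , a))
    ≡⟨ cong (a≢b ∧_) (antiPalPairsᵇ-++ s (indexed 1 Z) _) ⟩
  a≢b ∧ (antiPalPairsᵇ s (indexed 1 Z) ∧ antiPalPairsᵇ s [ (1 + length Z , b , a) ])
    ≡⟨ cong₂ (λ x y → a≢b ∧ (x ∧ y)) (antiPalPairsᵇ-shift L 0 Z) last ⟩
  a≢b ∧ (isAntiPalᵇ τ ∧ a≢b)
    ≡⟨ absorb a≢b (isAntiPalᵇ τ) ⟩
  a≢b ∧ isAntiPalᵇ τ ∎
  where
  open ≡-Reasoning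
  L = length τ
  s = suc (suc L)
  Z = zip τ (reverse τ)
  a≢b = not (does (a ≟ b))
  length-σ : length (a ∷ τ ∷ʳ b) ≡ s
  length-σ = cong suc (trans (length-++ τ) (+-comm L 1))
  reverse-σ : reverse (a ∷ τ ∷ʳ b) ≡ b ∷ reverse τ ∷ʳ a
  reverse-σ = trans (unfold-reverse a (τ ∷ʳ b)) (cong (_∷ʳ a) (reverse-++ τ [ b ]))
  length-Z : length Z ≡ L
  length-Z = trans (length-zipWith _,_ τ (reverse τ)) (trans (cong (L ⊓_) (length-reverse τ)) (⊓-idem L))
  not-middle : ∀ L → does (suc L + suc L + 1 ≟ suc (suc L)) ≡ false
  not-middle L = dec-false (suc L + suc L + 1 ≟ suc (suc L))
                           (λ eq → m≢1+m+n (suc (suc L)) (trans (sym eq) (last-index L)))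
    where
    last-index : ∀ L → suc L + suc L + 1 ≡ suc (suc (suc L) + L)
    last-index = solve-∀
  last : antiPalPairsᵇ s [ (1 + length Z , b , a) ] ≡ a≢b
  last = begin
    antiPalPairsᵇ s [ (1 + length Z , b , a) ]
      ≡⟨ trans (antiPalPairsᵇ-∷ s (1 + length Z) b a []) (∧-identityʳ _) ⟩
    does (1 + length Z + (1 + length Z) + 1 ≟ s) ∨ not (does (b ≟ a))
      ≡⟨ cong₂ (λ m e → m ∨ not e)
               (trans (cong (λ k → does (suc k + suc k + 1 ≟ s)) length-Z) (not-middle L))
               (does-⇔ (mk⇔ sym sym) (b ≟ a) (a ≟ b)) ⟩
    a≢b ∎
  absorb : ∀ x y → x ∧ (y ∧ x) ≡ x ∧ y
  absorb true  y = ∧-identityʳ y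
  absorb false y = refl

racRec : ℕ → ℕ → ℕ
racRec 0             0       = 1
racRec 0             (suc n) = 0
racRec 1             0       = 0
racRec 1             (suc n) = 1
racRec (suc (suc s)) n       = conv n ltPairs (racRec s)

𝟙-≢ : ∀ a b → 𝟙 (not (does (a ≟ b))) ≡ 𝟙 (a <ᵇ b) + 𝟙 (b <ᵇ a)
𝟙-≢ zero    zero    = refl
𝟙-≢ zero    (suc b) = refl
𝟙-≢ (suc a) zero    = refl
𝟙-≢ (suc a) (suc b) = 𝟙-≢ a b

antiPalCount : ℕ → ℕ → ℕ
antiPalCount n s = compCount isAntiPalᵇ n s

-- Outer parts a ≠ b have a < b or b < a, and swapping them matches the two cases.
antiPalCount-+2 : ∀ n s → antiPalCount n (suc (suc s)) ≡ 2 * conv n ltPairs (λ r → antiPalCount r s)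
antiPalCount-+2 n s = begin
  antiPalCount n (suc (suc s))
    ≡⟨ compCount-suc isAntiPalᵇ n (suc s) ⟩
  splitSum n (λ a m → compCount (isAntiPalᵇ ∘ (a ∷_)) m (suc s))
    ≡⟨ splitSum-cong n (λ a m → compCount-sucʳ s (isAntiPalᵇ ∘ (a ∷_)) m) ⟩
  splitSum n (λ a m → splitSum m (λ b r → compCount (λ τ → isAntiPalᵇ (a ∷ τ ∷ʳ b)) r s))
    ≡⟨ splitSum-cong n (λ a m → splitSum-cong m (λ b r → wrapped a b r)) ⟩
  splitSum n (λ a m → splitSum m (λ b r → 𝟙 (a <ᵇ b) * X r + 𝟙 (b <ᵇ a) * X r))
    ≡⟨ splitSum-cong n (λ a m → splitSum-+ m _ _) ⟩
  splitSum n (λ a m → splitSum m (λ b r → 𝟙 (a <ᵇ b) * X r) + splitSum m (λ b r → 𝟙 (b <ᵇ a) * X r))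
    ≡⟨ splitSum-+ n _ _ ⟩
  S + splitSum n (λ a m → splitSum m (λ b r → 𝟙 (b <ᵇ a) * X r))
    ≡⟨ cong (_+_ S) (sym (splitSum-swap n (λ a b r → 𝟙 (a <ᵇ b) * X r))) ⟩
  S + S
    ≡⟨ cong₂ _+_ (splitSum-nested-<ᵇ n X) (trans (splitSum-nested-<ᵇ n X) (sym (+-identityʳ _))) ⟩
  2 * conv n ltPairs X ∎
  where
  open ≡-Reasoning
  X : ℕ → ℕ
  X r = antiPalCount r s
  S = splitSum n (λ a m → splitSum m (λ b r → 𝟙 (a <ᵇ b) * X r))
  wrapped : ∀ a b r →
    compCount (λ τ → isAntiPalᵇ (a ∷ τ ∷ʳ b)) r s ≡ 𝟙 (a <ᵇ b) * X r + 𝟙 (b <ᵇ a) * X r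
  wrapped a b r = begin
    compCount (λ τ → isAntiPalᵇ (a ∷ τ ∷ʳ b)) r s
      ≡⟨ count-cong (compositions r s) (λ τ → isAntiPalᵇ-∷-∷ʳ a τ b) ⟩
    compCount (λ τ → not (does (a ≟ b)) ∧ isAntiPalᵇ τ) r s
      ≡⟨ count-∧ (not (does (a ≟ b))) isAntiPalᵇ (compositions r s) ⟩
    𝟙 (not (does (a ≟ b))) * X r
      ≡⟨ cong (_* X r) (𝟙-≢ a b) ⟩
    (𝟙 (a <ᵇ b) + 𝟙 (b <ᵇ a)) * X r
      ≡⟨ *-distribʳ-+ (X r) (𝟙 (a <ᵇ b)) (𝟙 (b <ᵇ a)) ⟩
    𝟙 (a <ᵇ b) * X r + 𝟙 (b <ᵇ a) * X r ∎

antiPalCount≡racRec*2^⌊s/2⌋ : ∀ s n → antiPalCount n s ≡ racRec s n * 2 ^ ⌊ s /2⌋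
antiPalCount≡racRec*2^⌊s/2⌋ 0             0       = refl
antiPalCount≡racRec*2^⌊s/2⌋ 0             (suc n) = refl
antiPalCount≡racRec*2^⌊s/2⌋ 1             0       = refl
antiPalCount≡racRec*2^⌊s/2⌋ 1             (suc n) =
  trans (compCount-suc isAntiPalᵇ (suc n) 0)
        (trans (splitSum-suc n (λ a m → compCount (isAntiPalᵇ ∘ (a ∷_)) m 0)) (cong suc (splitSum-zeros n)))
antiPalCount≡racRec*2^⌊s/2⌋ (suc (suc s)) n = begin
  antiPalCount n (suc (suc s))
    ≡⟨ antiPalCount-+2 n s ⟩
  2 * conv n ltPairs (λ r → antiPalCount r s)
    ≡⟨ cong (2 *_) (conv-cong n ltPairs (antiPalCount≡racRec*2^⌊s/2⌋ s)) ⟩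
  2 * conv n ltPairs (λ r → racRec s r * 2 ^ ⌊ s /2⌋)
    ≡⟨ cong (2 *_) (conv-*ʳ n ltPairs (racRec s) (2 ^ ⌊ s /2⌋)) ⟩
  2 * (racRec (suc (suc s)) n * 2 ^ ⌊ s /2⌋)
    ≡⟨ *-left-comm 2 (racRec (suc (suc s)) n) _ ⟩
  racRec (suc (suc s)) n * 2 ^ ⌊ suc (suc s) /2⌋ ∎
  where open ≡-Reasoning

rac≡racRec : ∀ n s → rac n s ≡ racRec s n
rac≡racRec n s = begin
  _/_ (length (filter isAntiPal? (compositions n s))) (2 ^ ⌊ s /2⌋) {{2^⌊s/2⌋≢0}}
    ≡⟨ cong (λ x → _/_ x (2 ^ ⌊ s /2⌋) {{2^⌊s/2⌋≢0}})
            (trans (length-filter≡count isAntiPal? (compositions n s)) (antiPalCount≡racRec*2^⌊s/2⌋ s n)) ⟩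
  _/_ (racRec s n * 2 ^ ⌊ s /2⌋) (2 ^ ⌊ s /2⌋) {{2^⌊s/2⌋≢0}}
    ≡⟨ m*n/n≡m (racRec s n) (2 ^ ⌊ s /2⌋) {{2^⌊s/2⌋≢0}} ⟩
  racRec s n ∎
  where
  open ≡-Reasoning
  2^⌊s/2⌋≢0 = m^n≢0 2 ⌊ s /2⌋

φ≡racRec : ∀ n s → φ n s ≡ + racRec s n
φ≡racRec 0 0                          = refl
φ≡racRec 0 1                          = refl
φ≡racRec 0 (suc (suc s))              = refl
φ≡racRec 1 0                          = refl
φ≡racRec 1 1                          = refl
φ≡racRec 1 (suc (suc s))              = refl
φ≡racRec 2 0                          = refl
φ≡racRec 2 1                          = refl
φ≡racRec 2 (suc (suc s))              = refl
φ≡racRec 3 0                          = refl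
φ≡racRec 3 1                          = refl
φ≡racRec 3 2                          = refl
φ≡racRec 3 3                          = refl
φ≡racRec 3 (suc (suc (suc (suc s))))  = refl
φ≡racRec (suc (suc (suc (suc n)))) s =
  step s (φ≡racRec (suc (suc (suc n)))) (φ≡racRec (suc (suc n))) (φ≡racRec (suc n))
  where
  ℕ-recurrence⇒ℤ : ∀ {a b c d e} → e + d ≡ a + b + c → + a ℤ.+ (+ b ℤ.+ (+ c ℤ.- + d)) ≡ + e
  ℕ-recurrence⇒ℤ {a} {b} {c} {d} {e} eq = begin
    + a ℤ.+ (+ b ℤ.+ (+ c ℤ.- + d)) ≡⟨ regroup (+ a) (+ b) (+ c) (+ d) ⟩
    (+ a ℤ.+ + b ℤ.+ + c) ℤ.- + d   ≡⟨ cong (ℤ._- + d) (sym (trans (ℤ.pos-+ (a + b) c)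
                                                                (cong (ℤ._+ + c) (ℤ.pos-+ a b)))) ⟩
    + (a + b + c) ℤ.- + d           ≡⟨ cong (λ x → + x ℤ.- + d) (sym eq) ⟩
    + (e + d) ℤ.- + d               ≡⟨ cong (ℤ._- + d) (ℤ.pos-+ e d) ⟩
    (+ e ℤ.+ + d) ℤ.- + d           ≡⟨ cancel (+ e) (+ d) ⟩
    + e ∎
    where
    open ≡-Reasoning
    regroup : ∀ a b c d → a ℤ.+ (b ℤ.+ (c ℤ.- d)) ≡ ((a ℤ.+ b) ℤ.+ c) ℤ.- d
    regroup = ℤ-Solver.solve-∀
    cancel : ∀ e d → (e ℤ.+ d) ℤ.- d ≡ e
    cancel = ℤ-Solver.solve-∀
  step : ∀ s → (∀ s → φ (3 + n) s ≡ + racRec s (3 + n)) →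
               (∀ s → φ (2 + n) s ≡ + racRec s (2 + n)) →
               (∀ s → φ (1 + n) s ≡ + racRec s (1 + n)) →
               φ (4 + n) s ≡ + racRec s (4 + n)
  step 0 φ₃ φ₂ φ₁ rewrite φ₃ 0 | φ₂ 0 | φ₁ 0 = refl
  step 1 φ₃ φ₂ φ₁ rewrite φ₃ 1 | φ₂ 1 | φ₁ 1 = refl
  step (suc (suc t)) φ₃ φ₂ φ₁ rewrite φ₃ (2 + t) | φ₂ (2 + t) | φ₁ (2 + t) | φ₁ t =
    ℕ-recurrence⇒ℤ (conv-ltPairs-recurrence (suc n) (racRec t))

theorem4 : (n s : ℕ) → φ n s ≡ + rac n s
theorem4 n s = trans (φ≡racRec n s) (cong +_ (sym (rac≡racRec n s)))
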